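{- Let $n\ge 2$ and $p\in\{2,3,\dots,n\}$ be integers. Then the graph $G=K_{p-1}+\overline{K_{n-p+1}}$ has order $n$ and $\chi_{ld}(G)=p$. In particular, for every $p\in\{2,\dots,n\}$ there exists a graph $G$ of order $n$ with $\chi_{ld}(G)=p$.
   Context: For a graph $G=(V,E)$ of order $n$ and a bijection $f\colon V\to\{1,\dots,n\}$, the weight of a vertex $u$ is $w(u)=\sum_{x\in N(u)}f(x)$, where $N(u)$ is the open neighborhood of $u$. The bijection $f$ is a local distance antimagic labeling if $w(u)\neq w(v)$ for every edge $uv$; it induces a proper vertex coloring assigning color $w(v)$ to $v$. The local distance antimagic chromatic number $\chi_{ld}(G)$ is the minimum number of distinct weights (colors) over all local distance antimagic labelings of $G$. $K_r$ is the complete graph on $r$ vertices, $\overline{K_r}$ is its complement (the edgeless graph on $r$ vertices), and $G+H$ denotes the join of $G$ and $H$ (disjoint union plus all edges between $V(G)$ and $V(H)$). -}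

module Defs where

open import Data.Nat using (ℕ; zero; suc; _+_; _<_; _≤_; _∸_; _<ᵇ_)
open import Data.Nat.Properties using (_≟_)
open import Data.Bool using (Bool; true; false; if_then_else_; _∨_; _∧_; not)
open import Data.Fin using (Fin; toℕ)
import Data.Fin as Fin
open import Data.Fin.Properties using () renaming (_≟_ to _≟ᶠ_)
open import Data.List using (List; length; map; allFin)
open import Data.Nat.ListAction using (sum)
open import Data.List.Relation.Unary.Unique.Propositional using (Unique)
open import Data.List.Membership.Propositional using (_∈_)
open import Data.Product using (Σ; _×_; _,_; ∃)
open import Function.Bundles using (Bijection)
open import Relation.Binary.PropositionalEquality using (_≡_; _≢_; setoid; refl; sym)
open import Relation.Nullary using (¬_; does)
import Relation.Nullary
import Data.Empty

record Graph (n : ℕ) : Set where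
  field
    adj   : Fin n → Fin n → Bool
    adj-sym : ∀ u v → adj u v ≡ adj v u
    adj-irrefl : ∀ u → adj u u ≡ false

open Graph public

-- A labeling is a bijection f : V → {1,…,n}; we represent {1,…,n} by Fin n,
-- with vertex v receiving the label toℕ (f v) + 1.
Labeling : ℕ → Set
Labeling n = Bijection (setoid (Fin n)) (setoid (Fin n))

label : ∀ {n} → Labeling n → Fin n → ℕ
label f v = suc (toℕ (Bijection.to f v))

weight : ∀ {n} → Graph n → Labeling n → Fin n → ℕ
weight G f u = sum (map (λ x → if adj G u x then label f x else 0) (allFin _))

IsLDA : ∀ {n} → Graph n → Labeling n → Set
IsLDA G f = ∀ u v → adj G u v ≡ true → weight G f u ≢ weight G f v

-- The number of colours used by f is the number of distinct weights:
-- NumColours G f k  iff some duplicate-free list of length k has exactly the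
-- values of the weight function as its members.
NumColours : ∀ {n} → Graph n → Labeling n → ℕ → Set
NumColours G f k =
  Σ (List ℕ) λ ws → Unique ws × length ws ≡ k ×
    (∀ c → c ∈ ws → ∃ λ v → weight G f v ≡ c) ×
    (∀ v → weight G f v ∈ ws)

ChiLD : ∀ {n} → Graph n → ℕ → Set
ChiLD G p =
  (Σ (Labeling _) λ f → IsLDA G f × NumColours G f p) ×
  (∀ f k → IsLDA G f → NumColours G f k → p ≤ k)

-- The join K_{p-1} + (complement of K_{n-p+1}) on vertex set Fin n:
-- vertices with index < p-1 form the clique K_{p-1}, the remaining n-p+1
-- vertices form the independent set; two distinct vertices are adjacent
-- iff at least one of them lies in the clique.
inClique : ∀ {n} → ℕ → Fin n → Bool
inClique p v = toℕ v <ᵇ (p ∸ 1)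

joinAdj : ∀ {n} → ℕ → Fin n → Fin n → Bool
joinAdj p u v = not (does (u ≟ᶠ v)) ∧ (inClique p u ∨ inClique p v)

private
  ∨-comm : ∀ a b → (a ∨ b) ≡ (b ∨ a)
  ∨-comm false false = refl
  ∨-comm false true = refl
  ∨-comm true false = refl
  ∨-comm true true = refl

  eqSym : ∀ {n} (u v : Fin n) → does (u ≟ᶠ v) ≡ does (v ≟ᶠ u)
  eqSym u v with u ≟ᶠ v | v ≟ᶠ u
  ... | Relation.Nullary.yes _ | Relation.Nullary.yes _ = refl
  ... | Relation.Nullary.no _  | Relation.Nullary.no _  = refl
  ... | Relation.Nullary.yes e | Relation.Nullary.no ne = Data.Empty.⊥-elim (ne (sym e))
  ... | Relation.Nullary.no ne | Relation.Nullary.yes e = Data.Empty.⊥-elim (ne (sym e))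

  joinSym : ∀ {n} p (u v : Fin n) → joinAdj p u v ≡ joinAdj p v u
  joinSym p u v rewrite eqSym u v | ∨-comm (inClique p u) (inClique p v) = refl

  joinIrrefl : ∀ {n} p (u : Fin n) → joinAdj p u u ≡ false
  joinIrrefl p u with u ≟ᶠ u
  ... | Relation.Nullary.yes _ = refl
  ... | Relation.Nullary.no ne = Data.Empty.⊥-elim (ne refl)

KJoin : (n p : ℕ) → Graph n
KJoin n p = record { adj = joinAdj p ; adj-sym = joinSym p ; adj-irrefl = joinIrrefl p }

-- The q = p − 1 clique vertices together with any one independent vertex form a
-- p-clique, and adjacent vertices get distinct weights, so at least p weights occur.
-- For the labeling v ↦ v + 1 a clique vertex u is adjacent to every other vertex, so
-- its weight is Σf − f(u), and these are pairwise distinct; every independent vertex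
-- has the same weight, the sum of the clique labels.  A clique weight equal to it
-- would force f(u) to be the sum of the independent labels, which is at least
-- q + 1 > f(u).  So exactly p weights occur.
module Submission where

open import Defs
open import Data.Bool using (Bool; true; false; if_then_else_)
open import Data.Empty using (⊥-elim)
open import Data.Fin using (Fin; zero; suc; toℕ; fromℕ; fromℕ<; inject≤)
open import Data.Fin.Properties
  using (toℕ-injective; toℕ-inject≤; inject≤-injective; toℕ-fromℕ; toℕ-fromℕ<; toℕ≤pred[n]; pigeonhole)
  renaming (_≟_ to _≟ᶠ_)
open import Data.List using (tabulate; lookup)
open import Data.List.Membership.Propositional using (_∈_)
open import Data.List.Membership.Propositional.Properties using (∈-tabulate⁺; ∈-tabulate⁻)
open import Data.List.Properties using (map-tabulate; length-tabulate)
open import Data.List.Relation.Unary.Any using (index)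
open import Data.List.Relation.Unary.Any.Properties using (lookup-index)
open import Data.List.Relation.Unary.Unique.Propositional.Properties using (tabulate⁺)
open import Data.Nat using (ℕ; zero; suc; _+_; _≤_; _<_; _∸_; _<ᵇ_; s≤s; _<?_)
open import Data.Nat.ListAction using (sum)
open import Data.Nat.Properties
  using (+-comm; +-assoc; +-cancelˡ-≡; +-identityʳ; m≤m+n; m≤n+m; ≤-trans; <-irrefl; ≮⇒≥;
         ≤∧≢⇒<; suc-injective; +-0-commutativeMonoid; m<n⇒m<1+n; <ᵇ-reflects-<)
  renaming (_≟_ to _≟ℕ_)
open import Algebra.Properties.CommutativeMonoid.Sum +-0-commutativeMonoid
  using (sum-cong-≗; ∑-distrib-+) renaming (sum to ∑)
open import Data.Product using (Σ; _×_; _,_; ∃)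
open import Function.Base using (_∘_)
open import Function.Bundles using (Bijection)
import Function.Construct.Identity as Identity
open import Relation.Binary.PropositionalEquality
open import Relation.Nullary using (yes; no; does; ¬_)
open import Relation.Nullary.Reflects using (ofʸ; ofⁿ)

sum-tabulate : ∀ {n} (g : Fin n → ℕ) → sum (tabulate g) ≡ ∑ g
sum-tabulate {zero}  g = refl
sum-tabulate {suc n} g = cong (g zero +_) (sum-tabulate (λ x → g (suc x)))

∑-split-if : ∀ {n} (b : Fin n → Bool) (g : Fin n → ℕ) →
  ∑ g ≡ ∑ (λ x → if b x then g x else 0) + ∑ (λ x → if b x then 0 else g x)
∑-split-if {n} b g = trans (sum-cong-≗ {n} split) (∑-distrib-+ {n} _ _)
  where
  split : ∀ x → g x ≡ (if b x then g x else 0) + (if b x then 0 else g x)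
  split x with b x
  ... | true  = sym (+-identityʳ (g x))
  ... | false = refl

∑-remove-+ : ∀ {n} (g : Fin n → ℕ) (u : Fin n) →
  ∑ (λ x → if does (u ≟ᶠ x) then 0 else g x) + g u ≡ ∑ g
∑-remove-+ {suc n} g zero    = +-comm (∑ (λ x → g (suc x))) (g zero)
∑-remove-+ {suc n} g (suc u) =
  trans (+-assoc (g zero) _ (g (suc u))) (cong (g zero +_) (∑-remove-+ (λ x → g (suc x)) u))

≤-∑ : ∀ {n} (g : Fin n → ℕ) (u : Fin n) → g u ≤ ∑ g
≤-∑ {suc n} g zero    = m≤m+n (g zero) _
≤-∑ {suc n} g (suc u) = ≤-trans (≤-∑ (λ x → g (suc x)) u) (m≤n+m _ (g zero))

IsClique : ∀ {m n} → Graph n → (Fin m → Fin n) → Set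
IsClique G c = ∀ i j → i ≢ j → adj G (c i) (c j) ≡ true

IsDominating : ∀ {n} → Graph n → Fin n → Set
IsDominating G u = ∀ x → u ≢ x → adj G u x ≡ true

module _ {n : ℕ} (G : Graph n) where

  weight-∑ : ∀ (f : Labeling n) u → weight G f u ≡ ∑ (λ x → if adj G u x then label f x else 0)
  weight-∑ f u = trans (cong sum (map-tabulate {n = n} (λ x → x) _)) (sum-tabulate {n} _)

  adjacent⇒≢ : ∀ {u v} → adj G u v ≡ true → u ≢ v
  adjacent⇒≢ {u} uv refl with trans (sym uv) (adj-irrefl G u)
  ... | ()

  weight-dominating : ∀ (f : Labeling n) {u} → IsDominating G u → weight G f u + label f u ≡ ∑ (label f)
  weight-dominating f {u} dom = begin
    weight G f u + label f u
      ≡⟨ cong (_+ label f u) (trans (weight-∑ f u) (sum-cong-≗ {n} neighbour)) ⟩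
    ∑ (λ x → if does (u ≟ᶠ x) then 0 else label f x) + label f u
      ≡⟨ ∑-remove-+ (label f) u ⟩
    ∑ (label f) ∎
    where
    open ≡-Reasoning
    neighbour : ∀ x → (if adj G u x then label f x else 0) ≡ (if does (u ≟ᶠ x) then 0 else label f x)
    neighbour x with u ≟ᶠ x
    ... | yes refl = cong (λ b → if b then label f u else 0) (adj-irrefl G u)
    ... | no u≢x  = cong (λ b → if b then label f x else 0) (dom x u≢x)

  dominating-weight-injective : ∀ (f : Labeling n) {u v} → IsDominating G u → IsDominating G v →
    weight G f u ≡ weight G f v → u ≡ v
  dominating-weight-injective f {u} {v} domᵤ domᵥ same =
    Bijection.injective f (toℕ-injective (suc-injective (+-cancelˡ-≡ (weight G f u) _ _ (begin
      weight G f u + label f u ≡⟨ weight-dominating f domᵤ ⟩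
      ∑ (label f)              ≡⟨ weight-dominating f domᵥ ⟨
      weight G f v + label f v ≡⟨ cong (_+ label f v) same ⟨
      weight G f u + label f v ∎))))
    where open ≡-Reasoning

  clique-size≤colours : ∀ {m k} (f : Labeling n) (c : Fin m → Fin n) →
    IsLDA G f → IsClique G c → NumColours G f k → m ≤ k
  clique-size≤colours f c lda clique (ws , _ , refl , _ , covered) = ≮⇒≥ λ k<m →
    let (i , j , i<j , sameIndex) = pigeonhole k<m (λ i → index (covered (c i)))
    in lda (c i) (c j) (clique i j λ i≡j → <-irrefl (cong toℕ i≡j) i<j)
         (trans (lookup-index (covered (c i)))
           (trans (cong (lookup ws) sameIndex) (sym (lookup-index (covered (c j))))))

  numColours-clique : ∀ {m} (f : Labeling n) (c : Fin m → Fin n) →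
    IsLDA G f → IsClique G c → (∀ v → ∃ λ i → weight G f v ≡ weight G f (c i)) →
    NumColours G f m
  numColours-clique {m} f c lda clique covers =
    tabulate w , tabulate⁺ w-injective , length-tabulate w ,
    (λ x x∈ws → let (i , x≡wᵢ) = ∈-tabulate⁻ x∈ws in c i , sym x≡wᵢ) ,
    (λ v → let (i , wᵥ≡wᵢ) = covers v in subst (_∈ tabulate w) (sym wᵥ≡wᵢ) (∈-tabulate⁺ i))
    where
    w : Fin m → ℕ
    w i = weight G f (c i)
    w-injective : ∀ {i j} → w i ≡ w j → i ≡ j
    w-injective {i} {j} same with i ≟ᶠ j
    ... | yes i≡j = i≡j
    ... | no i≢j  = ⊥-elim (lda (c i) (c j) (clique i j i≢j) same)

module _ {n : ℕ} (p : ℕ) where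

  inClique-true : ∀ {v : Fin n} → toℕ v < p ∸ 1 → inClique p v ≡ true
  inClique-true {v} v<p-1 with toℕ v <ᵇ (p ∸ 1) | <ᵇ-reflects-< (toℕ v) (p ∸ 1)
  ... | true  | _        = refl
  ... | false | ofⁿ v≮p-1 = ⊥-elim (v≮p-1 v<p-1)

  inClique-false : ∀ {v : Fin n} → ¬ toℕ v < p ∸ 1 → inClique p v ≡ false
  inClique-false {v} v≮p-1 with toℕ v <ᵇ (p ∸ 1) | <ᵇ-reflects-< (toℕ v) (p ∸ 1)
  ... | true  | ofʸ v<p-1 = ⊥-elim (v≮p-1 v<p-1)
  ... | false | _         = refl

  KJoin-dominating : ∀ {u : Fin n} → inClique p u ≡ true → IsDominating (KJoin n p) u
  KJoin-dominating {u} inClique-u x u≢x with u ≟ᶠ x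
  ... | yes u≡x = ⊥-elim (u≢x u≡x)
  ... | no _    rewrite inClique-u = refl

  KJoin-adj-independent : ∀ {v : Fin n} → inClique p v ≡ false → ∀ x → joinAdj p v x ≡ inClique p x
  KJoin-adj-independent {v} independent-v x with v ≟ᶠ x
  ... | yes refl = sym independent-v
  ... | no _     rewrite independent-v = refl

  weight-KJoin-independent : ∀ (f : Labeling n) {v} → inClique p v ≡ false →
    weight (KJoin n p) f v ≡ ∑ (λ x → if inClique p x then label f x else 0)
  weight-KJoin-independent f {v} independent-v =
    trans (weight-∑ (KJoin n p) f v)
      (sum-cong-≗ {n} λ x → cong (λ b → if b then label f x else 0) (KJoin-adj-independent independent-v x))

module KJoin-χld {n q : ℕ} (p≤n : suc q ≤ n) where

  G : Graph n
  G = KJoin n (suc q)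

  vertex : Fin (suc q) → Fin n
  vertex i = inject≤ i p≤n

  toℕ-vertex : ∀ i → toℕ (vertex i) ≡ toℕ i
  toℕ-vertex i = toℕ-inject≤ i p≤n

  inClique-vertex : ∀ {i} → toℕ i ≢ q → inClique (suc q) (vertex i) ≡ true
  inClique-vertex {i} i≢q = inClique-true (suc q)
    (subst (_< q) (sym (toℕ-vertex i)) (≤∧≢⇒< (toℕ≤pred[n] i) i≢q))

  vertex-≢ : ∀ {i j} → i ≢ j → vertex i ≢ vertex j
  vertex-≢ {i} {j} i≢j same = i≢j (inject≤-injective p≤n p≤n i j same)

  isClique : IsClique G vertex
  isClique i j i≢j with toℕ i ≟ℕ q | toℕ j ≟ℕ q
  ... | yes i≡q | yes j≡q = ⊥-elim (i≢j (toℕ-injective (trans i≡q (sym j≡q))))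
  ... | yes _   | no j≢q  = trans (adj-sym G (vertex i) (vertex j))
    (KJoin-dominating (suc q) (inClique-vertex j≢q) (vertex i) (vertex-≢ (i≢j ∘ sym)))
  ... | no i≢q  | _       = KJoin-dominating (suc q) (inClique-vertex i≢q) (vertex j) (vertex-≢ i≢j)

  lowerBound : ∀ f k → IsLDA G f → NumColours G f k → suc q ≤ k
  lowerBound f k lda = clique-size≤colours G f vertex lda isClique

  top : Fin n
  top = vertex (fromℕ q)

  toℕ-top : toℕ top ≡ q
  toℕ-top = trans (toℕ-vertex (fromℕ q)) (toℕ-fromℕ q)

  top-independent : inClique (suc q) top ≡ false
  top-independent = inClique-false (suc q) (<-irrefl toℕ-top)

  idLabeling : Labeling n
  idLabeling = Identity.bijection (setoid (Fin n))

  lab : Fin n → ℕ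
  lab = label idLabeling

  cliqueSum independentSum : ℕ
  cliqueSum      = ∑ (λ x → if inClique (suc q) x then lab x else 0)
  independentSum = ∑ (λ x → if inClique (suc q) x then 0 else lab x)

  q<independentSum : q < independentSum
  q<independentSum = subst (_≤ independentSum)
    (trans (cong (λ b → if b then 0 else lab top) top-independent) (cong suc toℕ-top))
    (≤-∑ (λ x → if inClique (suc q) x then 0 else lab x) top)

  clique-weight≢independent-weight : ∀ {u v} → toℕ u < q → inClique (suc q) v ≡ false →
    weight G idLabeling u ≢ weight G idLabeling v
  clique-weight≢independent-weight {u} {v} u<q independent-v same =
    <-irrefl lab-u≡independentSum (≤-trans (s≤s u<q) q<independentSum)
    where
    open ≡-Reasoning
    lab-u≡independentSum : lab u ≡ independentSum
    lab-u≡independentSum = +-cancelˡ-≡ cliqueSum _ _ (begin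
      cliqueSum + lab u
        ≡⟨ cong (_+ lab u) (weight-KJoin-independent (suc q) idLabeling independent-v) ⟨
      weight G idLabeling v + lab u
        ≡⟨ cong (_+ lab u) same ⟨
      weight G idLabeling u + lab u
        ≡⟨ weight-dominating G idLabeling (KJoin-dominating (suc q) (inClique-true (suc q) u<q)) ⟩
      ∑ lab
        ≡⟨ ∑-split-if (inClique (suc q)) lab ⟩
      cliqueSum + independentSum ∎)

  isLDA : IsLDA G idLabeling
  isLDA u v uv with toℕ u <? q | toℕ v <? q
  ... | yes u<q | yes v<q = λ same → adjacent⇒≢ G uv
    (dominating-weight-injective G idLabeling (dominating u<q) (dominating v<q) same)
    where
    dominating : ∀ {w} → toℕ w < q → IsDominating G w
    dominating w<q = KJoin-dominating (suc q) (inClique-true (suc q) w<q)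
  ... | yes u<q | no v≮q  = clique-weight≢independent-weight u<q (inClique-false (suc q) v≮q)
  ... | no u≮q  | yes v<q = clique-weight≢independent-weight v<q (inClique-false (suc q) u≮q) ∘ sym
  ... | no u≮q  | no v≮q  with trans (sym uv)
    (trans (KJoin-adj-independent (suc q) (inClique-false (suc q) u≮q) v) (inClique-false (suc q) v≮q))
  ... | ()

  weight-vertex : ∀ v → ∃ λ i → weight G idLabeling v ≡ weight G idLabeling (vertex i)
  weight-vertex v with toℕ v <? q
  ... | yes v<q = i , cong (weight G idLabeling) (sym vertex-i≡v)
    where
    v<p : toℕ v < suc q
    v<p = m<n⇒m<1+n v<q
    i : Fin (suc q)
    i = fromℕ< v<p
    vertex-i≡v : vertex i ≡ v
    vertex-i≡v = toℕ-injective (trans (toℕ-vertex i) (toℕ-fromℕ< v<p))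
  ... | no v≮q  = fromℕ q ,
    trans (weight-KJoin-independent (suc q) idLabeling (inClique-false (suc q) v≮q))
          (sym (weight-KJoin-independent (suc q) idLabeling top-independent))

  χld : ChiLD G (suc q)
  χld = (idLabeling , isLDA , numColours-clique G idLabeling vertex isLDA isClique weight-vertex)
      , lowerBound

mainTheorem1 : (n p : ℕ) → 2 ≤ n → 2 ≤ p → p ≤ n →
    ChiLD (KJoin n p) p × Σ (Graph n) (λ G → ChiLD G p)
mainTheorem1 n zero    _ () _
mainTheorem1 n (suc q) _ _  p≤n = χld , G , χld
  where open KJoin-χld p≤n
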